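{- Let $n\in\mathbb{N}$ and let $\alpha$ be a unit-interval parking function of length $n$ that decomposes into $k$ component primes, the $j$-th of which has length $\ell(j)$. For $j\in[k]$, let $c_{1,j},\dots,c_{\ell(j),j}$ be the positions (cars) of $\alpha$ whose preferences make up the $j$-th prime, listed in order of the preferences within that prime. Then the transpositions $(c_{i,j}\ c_{i+1,j})$ for $j\in[k]$ and $i\in[\ell(j)-1]$ generate the stabilizer, under the coordinate-permutation action of $S_n$, of the face of the permutohedron $P(n)$ that $\alpha$ labels, and this stabilizer has order $\prod_{j\in[k]}\ell(j)!$.
   Context: $P(n)=\operatorname{conv}\{(w(1),\dots,w(n)): w\text{ a permutation of }[n]\}$; $S_n$ acts on faces by permuting coordinates, and the stabilizer of a face $F$ is $\{\tau\in S_n:\tau(F)=F\}$. A parking function of length $n$ is $\alpha=(a_1,\dots,a_n)\in[n]^n$ such that cars $1,\dots,n$, arriving in order and each parking in the first free spot $\ge a_i$, all park in spots $1,\dots,n$; it is unit-interval if each car parks at most one spot past its preference. Breakpoints: $k$ with $|\{i:a_i\le k\}|=k$. If $b_1<\dots<b_k=n$ are the breakpoints ($b_0=0$) and $\sigma(t)$ is the car parking in spot $t$, the $j$-th component prime consists of the preferences of cars $\sigma(b_{j-1}+1),\dots,\sigma(b_j)$, so $\ell(j)=b_j-b_{j-1}$. The face labeled by $\alpha$ is $F_{B_1/\cdots/B_k}$ with $B_j=\{\sigma(b_{j-1}+1),\dots,\sigma(b_j)\}$, where $F_{B_1/\cdots/B_k}$ is the convex hull of the vertices $x$ of $P(n)$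 with $x_i<x_{i'}$ whenever $i\in B_a$, $i'\in B_b$, $a<b$. -}

module Defs where

open import Data.Bool using (Bool; true; false; if_then_else_)
open import Data.Bool.ListAction using (any)
open import Data.Nat using (ℕ; zero; suc; _+_; _∸_; _≤_; _<_; _≡ᵇ_; _≤?_; _<?_; _≟_)

open import Data.Fin using (Fin; toℕ) renaming (_≟_ to _≟ᶠ_)
open import Data.Vec using (Vec; lookup; tabulate; toList; []; _∷_)
open import Data.List using (List; length; filter; map; upTo) renaming ([] to []ˡ; _∷_ to _∷ˡ_)
open import Data.List.Membership.Propositional using (_∈_)
open import Data.List.Relation.Unary.Unique.Propositional using (Unique)
open import Data.Product using (Σ; ∃; _×_; _,_)
open import Relation.Nullary using (does)
open import Relation.Binary.PropositionalEquality using (_≡_)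

-- Parking process.  Preferences and spots are numbered 1,2,...;
-- cars are indexed by Fin n (car t+1 is index t).

-- first free spot ≥ a, given the list O of occupied spots
-- (fuel length O + 1 is always enough)
nextFree : ℕ → List ℕ → ℕ → ℕ
nextFree zero    O a = a
nextFree (suc f) O a = if any (λ o → o ≡ᵇ a) O then nextFree f O (suc a) else a

parkFrom : ∀ {m} → List ℕ → Vec ℕ m → Vec ℕ m
parkFrom O []       = []
parkFrom O (a ∷ as) =
  let s = nextFree (suc (length O)) O a in s ∷ parkFrom (s ∷ˡ O) as

spot : ∀ {n} → Vec ℕ n → Fin n → ℕ
spot α i = lookup (parkFrom []ˡ α) i

IsParkingFunction : ∀ {n} → Vec ℕ n → Set
IsParkingFunction {n} α =
  (∀ i → 1 ≤ lookup α i × lookup α i ≤ n) × (∀ i → spot α i ≤ n)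

IsUnitInterval : ∀ {n} → Vec ℕ n → Set
IsUnitInterval α = ∀ i → spot α i ≤ suc (lookup α i)

count≤ : ∀ {n} → Vec ℕ n → ℕ → ℕ
count≤ α t = length (filter (λ a → a ≤? t) (toList α))

breakpoints : ∀ {n} → Vec ℕ n → List ℕ
breakpoints {n} α = filter (λ t → count≤ α t ≟ t) (map suc (upTo n))

diffs : ℕ → List ℕ → List ℕ
diffs p []ˡ       = []ˡ
diffs p (b ∷ˡ bs) = (b ∸ p) ∷ˡ diffs b bs

primeLengths : ∀ {n} → Vec ℕ n → List ℕ
primeLengths α = diffs 0 (breakpoints α)

-- block index (0-based) of car i: car i ∈ B_{j+1} iff
-- b_j < spot i ≤ b_{j+1} iff exactly j breakpoints are < spot i
blk : ∀ {n} → Vec ℕ n → Fin n → ℕ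
blk α i = length (filter (λ b → b <? spot α i) (breakpoints α))

-- Permutations of [n] as vectors (one-line notation, values 0..n-1)

IsPerm : ∀ {n} → Vec (Fin n) n → Set
IsPerm {n} w =
  (∀ i i' → lookup w i ≡ lookup w i' → i ≡ i') × (∀ j → ∃ λ i → lookup w i ≡ j)

-- vertex x of P(n) (coordinates shifted by -1) lies in the face F_{B_1/.../B_k}
InFace : ∀ {n} → Vec ℕ n → Vec (Fin n) n → Set
InFace α x = ∀ i i' → blk α i < blk α i' → toℕ (lookup x i) < toℕ (lookup x i')

Acts : ∀ {n} → Vec (Fin n) n → Vec (Fin n) n → Vec (Fin n) n → Set
Acts τ x y = ∀ i → lookup y (lookup τ i) ≡ lookup x i

Stabilizes : ∀ {n} → Vec ℕ n → Vec (Fin n) n → Set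
Stabilizes α τ = ∀ x y → IsPerm x → IsPerm y → Acts τ x y →
  (InFace α x → InFace α y) × (InFace α y → InFace α x)

InStabilizer : ∀ {n} → Vec ℕ n → Vec (Fin n) n → Set
InStabilizer α τ = IsPerm τ × Stabilizes α τ

idPerm : ∀ {n} → Vec (Fin n) n
idPerm = tabulate (λ i → i)

transposition : ∀ {n} → Fin n → Fin n → Vec (Fin n) n
transposition a b = tabulate (λ x →
  if does (x ≟ᶠ a) then b else if does (x ≟ᶠ b) then a else x)

compose : ∀ {n} → Vec (Fin n) n → Vec (Fin n) n → Vec (Fin n) n
compose g σ = tabulate (λ i → lookup g (lookup σ i))

-- the subgroup of S_n generated by the permutations satisfying G
-- (in a finite group the generated submonoid is the generated subgroup)
data Generated {n} (G : Vec (Fin n) n → Set) : Vec (Fin n) n → Set where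
  gen-id   : Generated G idPerm
  gen-step : ∀ {g σ} → G g → Generated G σ → Generated G (compose g σ)

Listing : ∀ {n} → Vec ℕ n → Set
Listing {n} α =
  (j : Fin (length (primeLengths α))) → Fin (Data.List.lookup (primeLengths α) j) → Fin n

IsListing : ∀ {n} (α : Vec ℕ n) → Listing α → Set
IsListing {n} α c =
  (∀ j i → blk α (c j i) ≡ toℕ j) ×
  (∀ j i i' → c j i ≡ c j i' → i ≡ i') ×
  (∀ j (x : Fin n) → blk α x ≡ toℕ j → ∃ λ i → c j i ≡ x) ×
  (∀ j i i' → toℕ i < toℕ i' → lookup α (c j i) ≤ lookup α (c j i'))

IsListingGenerator : ∀ {n} (α : Vec ℕ n) → Listing α → Vec (Fin n) n → Set
IsListingGenerator α c g =
  ∃ λ j → ∃ λ i → ∃ λ i' → suc (toℕ i) ≡ toℕ i' × g ≡ transposition (c j i) (c j i')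

{-# OPTIONS --safe #-}
module Submission where

-- Let B_j be the set of cars i with blk α i = j. A vertex x of P(n) lies on the face F_{B_1/⋯/B_k} iff it
-- ranks the cars of earlier blocks below those of later ones. Counting then confines x_i, for i ∈ B_j, to the
-- interval [|B_1 ∪ ⋯ ∪ B_{j-1}|, |B_1 ∪ ⋯ ∪ B_j|), so on the face the position of a car determines its block.
-- The face is nonempty (rank the cars by block, then by index), and τ moves a vertex v on it to a vertex y with
-- y(τ i) = v(i); hence τ stabilizes the face iff it maps each block to itself. This Young subgroup is listed
-- recursively, the first car being sent to itself or to a later car of its block, which gives ∏ |B_j|! = ∏ ℓ(j)!
-- elements, each a product of transpositions inside a block; these are conjugates (y z)(x y)(y z) = (x z) of the
-- adjacent transpositions (c_{i,j} c_{i+1,j}).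

open import Data.Bool using (if_then_else_)
open import Data.Fin using (Fin; toℕ; fromℕ<; inject≤; punchOut) renaming (zero to fzero; suc to fsuc)
open import Data.Fin.Properties
  using ( toℕ-injective; suc-injective; toℕ-fromℕ<; toℕ<n; toℕ-inject≤; inject≤-injective
        ; any?; punchOut-injective; injective⇒≤ )
  renaming (_≟_ to _≟ᶠ_)
import Data.List as List
open import Data.List using (List; []; _∷_; _++_; length; map; filter; upTo; allFin; cartesianProductWith)
open import Data.List.Membership.Propositional using (_∈_; _∉_)
open import Data.List.Membership.Propositional.Properties
  using ( ∈-∃++; ∈-++⁻; ∈-++⁺ˡ; ∈-++⁺ʳ; ∈-map⁺; ∈-map⁻; ∈-upTo⁺; ∈-allFin; ∈-filter⁺; ∈-filter⁻
        ; ∈-cartesianProductWith⁺; ∈-cartesianProductWith⁻ )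
open import Data.List.Properties
  using ( length-map; length-upTo; length-tabulate; length-++; tabulate-cong; map-tabulate; tabulate-lookup
        ; filter-accept; filter-reject; filter-all; filter-notAll )
open import Data.List.Relation.Binary.Disjoint.Propositional using (Disjoint)
open import Data.List.Relation.Binary.Permutation.Propositional.Properties using (↭-length; shift)
open import Data.List.Relation.Binary.Subset.Propositional using (_⊆_)
open import Data.List.Relation.Unary.All as All using (All)
open import Data.List.Relation.Unary.AllPairs using ([]; _∷_)
import Data.List.Relation.Unary.Any as Any
open import Data.List.Relation.Unary.Any using (here; there)
open import Data.List.Relation.Unary.Unique.Propositional using (Unique)
import Data.List.Relation.Unary.Unique.Propositional.Properties as Unique
open import Data.Nat using (ℕ; zero; suc; _+_; _*_; _≤_; _<_; z≤n; s≤s; s≤s⁻¹; _<?_; _≤?_; _≟_; _!)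
open import Data.Nat.ListAction using (product)
open import Data.Nat.Properties
  using ( ≤-refl; ≤-reflexive; ≤-trans; ≤-antisym; <-trans; ≤-<-trans; <-≤-trans; <-cmp; <-strictTotalOrder
        ; <⇒≤; <⇒≢; <⇒≱; ≮⇒≥; 1+n≰n; n<1+n; m≤n+m; m∸n+n≡m; *-assoc; *-commutativeSemigroup
        ; module ≤-Reasoning )
open import Algebra.Properties.CommutativeSemigroup *-commutativeSemigroup using (x∙yz≈y∙xz)
open import Data.Product using (Σ; ∃; _×_; _,_; proj₁; proj₂)
open import Data.Product.Relation.Binary.Lex.Strict using (×-strictTotalOrder)
open import Data.Sum using (inj₁; inj₂)
open import Data.Vec using (Vec; lookup; tabulate; toList)
open import Data.Vec.Properties using (lookup∘tabulate; tabulate∘lookup; length-toList)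
import Data.Vec.Properties as Vec
open import Data.Vec.Relation.Unary.All.Properties using (toList⁺; lookup⁻)
open import Function.Base using (_∘_)
open import Function.Definitions using (Injective)
open import Relation.Binary.Bundles using (StrictTotalOrder)
open import Relation.Binary.Definitions using (tri<; tri≈; tri>)
open import Relation.Binary.PropositionalEquality
open import Relation.Nullary using (¬_; Dec; does; yes; no; contradiction)
open import Relation.Nullary.Decidable using (dec-true; dec-false)
open import Relation.Unary using (Decidable)

open import Defs

unique-⊆⇒length-≤ : ∀ {A : Set} {xs ys : List A} → Unique xs → xs ⊆ ys → length xs ≤ length ys
unique-⊆⇒length-≤ {xs = []} _ _ = z≤n
unique-⊆⇒length-≤ {xs = x ∷ xs} (x∉xs ∷ xs!) xs⊆ys
  with ys₁ , ys₂ , refl ← ∈-∃++ (xs⊆ys (here refl)) = begin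
    suc (length xs)           ≤⟨ s≤s (unique-⊆⇒length-≤ xs! xs⊆ys₁++ys₂) ⟩
    suc (length (ys₁ ++ ys₂)) ≡⟨ ↭-length (shift x ys₁ ys₂) ⟨
    length (ys₁ ++ x ∷ ys₂)   ∎
  where
  open ≤-Reasoning
  xs⊆ys₁++ys₂ : xs ⊆ ys₁ ++ ys₂
  xs⊆ys₁++ys₂ y∈xs with ∈-++⁻ ys₁ (xs⊆ys (there y∈xs))
  ... | inj₁ y∈ys₁         = ∈-++⁺ˡ y∈ys₁
  ... | inj₂ (here refl)   = contradiction refl (All.lookup x∉xs y∈xs)
  ... | inj₂ (there y∈ys₂) = ∈-++⁺ʳ ys₁ y∈ys₂

unique-injection⇒length-≤ : ∀ {A B : Set} {f : A → B} {xs ys} →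
  (∀ {x y} → f x ≡ f y → x ≡ y) → Unique xs → (∀ {x} → x ∈ xs → f x ∈ ys) → length xs ≤ length ys
unique-injection⇒length-≤ {f = f} {xs} f-inj xs! f[xs]⊆ys =
  subst (_≤ _) (length-map f xs) (unique-⊆⇒length-≤ (Unique.map⁺ f-inj xs!) image⊆ys)
  where
  image⊆ys : map f xs ⊆ _
  image⊆ys y∈image with x , x∈xs , refl ← ∈-map⁻ f y∈image = f[xs]⊆ys x∈xs

length-cartesianProductWith : ∀ {A B C : Set} (f : A → B → C) xs ys →
  length (cartesianProductWith f xs ys) ≡ length xs * length ys
length-cartesianProductWith f [] ys = refl
length-cartesianProductWith f (x ∷ xs) ys = begin
  length (map (f x) ys ++ cartesianProductWith f xs ys)      ≡⟨ length-++ (map (f x) ys) ⟩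
  length (map (f x) ys) + length (cartesianProductWith f xs ys)
    ≡⟨ cong₂ _+_ (length-map (f x) ys) (length-cartesianProductWith f xs ys) ⟩
  length ys + length xs * length ys                            ∎
  where open ≡-Reasoning

product-tabulate-1 : ∀ k → product (List.tabulate {n = k} (λ _ → 1)) ≡ 1
product-tabulate-1 zero    = refl
product-tabulate-1 (suc k) = cong (1 *_) (product-tabulate-1 k)

product-tabulate-scale : ∀ {k} (f g : Fin k → ℕ) c j → g j ≡ c * f j → (∀ j' → j' ≢ j → g j' ≡ f j') →
  product (List.tabulate g) ≡ c * product (List.tabulate f)
product-tabulate-scale f g c fzero gj≡cfj g≗f = begin
  g fzero * product (List.tabulate (g ∘ fsuc))       ≡⟨ cong₂ _*_ gj≡cfj (cong product g∘fsuc≡f∘fsuc) ⟩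
  c * f fzero * product (List.tabulate (f ∘ fsuc))   ≡⟨ *-assoc c (f fzero) _ ⟩
  c * (f fzero * product (List.tabulate (f ∘ fsuc))) ∎
  where
  open ≡-Reasoning
  g∘fsuc≡f∘fsuc : List.tabulate (g ∘ fsuc) ≡ List.tabulate (f ∘ fsuc)
  g∘fsuc≡f∘fsuc = tabulate-cong λ j' → g≗f (fsuc j') λ ()
product-tabulate-scale f g c (fsuc j) gj≡cfj g≗f = begin
  g fzero * product (List.tabulate (g ∘ fsuc))       ≡⟨ cong₂ _*_ (g≗f fzero λ ()) tail-scaled ⟩
  f fzero * (c * product (List.tabulate (f ∘ fsuc))) ≡⟨ x∙yz≈y∙xz (f fzero) c _ ⟩
  c * (f fzero * product (List.tabulate (f ∘ fsuc))) ∎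
  where
  open ≡-Reasoning
  tail-scaled : product (List.tabulate (g ∘ fsuc)) ≡ c * product (List.tabulate (f ∘ fsuc))
  tail-scaled = product-tabulate-scale (f ∘ fsuc) (g ∘ fsuc) c j gj≡cfj
    λ j' j'≢j → g≗f (fsuc j') (j'≢j ∘ suc-injective)

injective⇒surjective : ∀ {n} {f : Fin n → Fin n} → Injective _≡_ _≡_ f → ∀ j → ∃ λ i → f i ≡ j
injective⇒surjective {suc n} {f} f-inj j with any? (λ i → f i ≟ᶠ j)
... | yes hit = hit
... | no miss = contradiction (injective⇒≤ punchOut-f-injective) 1+n≰n
  where
  f≢j : ∀ i → j ≢ f i
  f≢j i j≡fi = miss (i , sym j≡fi)
  punchOut-f-injective : Injective _≡_ _≡_ (λ i → punchOut (f≢j i))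
  punchOut-f-injective eq = f-inj (punchOut-injective (f≢j _) (f≢j _) eq)

module _ {n : ℕ} {P : Fin n → Set} (P? : Decidable P) where

  ∈-filter-allFin⁺ : ∀ {i} → P i → i ∈ filter P? (allFin n)
  ∈-filter-allFin⁺ = ∈-filter⁺ P? (∈-allFin _)

  ∈-filter-allFin⁻ : ∀ {i} → i ∈ filter P? (allFin n) → P i
  ∈-filter-allFin⁻ i∈ = proj₂ (∈-filter⁻ P? {xs = allFin n} i∈)

Perm : ℕ → Set
Perm n = Vec (Fin n) n

lookup-ext : ∀ {A : Set} {n} {xs ys : Vec A n} → (∀ i → lookup xs i ≡ lookup ys i) → xs ≡ ys
lookup-ext {xs = xs} {ys} eq =
  trans (sym (tabulate∘lookup xs)) (trans (Vec.tabulate-cong eq) (tabulate∘lookup ys))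

transpose : ∀ {n} → Fin n → Fin n → Fin n → Fin n
transpose a b x = if does (x ≟ᶠ a) then b else if does (x ≟ᶠ b) then a else x

data TransposeView {n} (a b x : Fin n) : Fin n → Set where
  at-a      : x ≡ a → TransposeView a b x b
  at-b      : x ≢ a → x ≡ b → TransposeView a b x a
  elsewhere : x ≢ a → x ≢ b → TransposeView a b x x

module _ {n : ℕ} where

  transpose-view : ∀ (a b x : Fin n) → TransposeView a b x (transpose a b x)
  transpose-view a b x with x ≟ᶠ a
  ... | yes x≡a = at-a x≡a
  ... | no x≢a with x ≟ᶠ b
  ... | yes x≡b = at-b x≢a x≡b
  ... | no x≢b = elsewhere x≢a x≢b

  transpose-matchˡ : ∀ (a b : Fin n) → transpose a b a ≡ b
  transpose-matchˡ a b rewrite dec-true (a ≟ᶠ a) refl = refl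

  transpose-matchʳ : ∀ (a b : Fin n) → transpose a b b ≡ a
  transpose-matchʳ a b with b ≟ᶠ a
  ... | yes b≡a = b≡a
  ... | no _ rewrite dec-true (b ≟ᶠ b) refl = refl

  transpose-mismatch : ∀ {a b x : Fin n} → x ≢ a → x ≢ b → transpose a b x ≡ x
  transpose-mismatch {a} {b} {x} x≢a x≢b
    rewrite dec-false (x ≟ᶠ a) x≢a | dec-false (x ≟ᶠ b) x≢b = refl

  transpose-involutive : ∀ (a b x : Fin n) → transpose a b (transpose a b x) ≡ x
  transpose-involutive a b x with transpose a b x | transpose-view a b x
  ... | _ | at-a refl           = transpose-matchʳ x b
  ... | _ | at-b _ refl         = transpose-matchˡ a x
  ... | _ | elsewhere x≢a x≢b = transpose-mismatch x≢a x≢b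

  transpose-comm : ∀ (a b x : Fin n) → transpose a b x ≡ transpose b a x
  transpose-comm a b x with transpose a b x | transpose-view a b x
  ... | _ | at-a refl           = sym (transpose-matchʳ b x)
  ... | _ | at-b _ refl         = sym (transpose-matchˡ x a)
  ... | _ | elsewhere x≢a x≢b = sym (transpose-mismatch x≢b x≢a)

  transpose-self : ∀ (a x : Fin n) → transpose a a x ≡ x
  transpose-self a x with transpose a a x | transpose-view a a x
  ... | _ | at-a refl     = refl
  ... | _ | at-b _ refl   = refl
  ... | _ | elsewhere _ _ = refl

  transpose-conjugate : ∀ {x y z : Fin n} → x ≢ y → y ≢ z → x ≢ z →
    ∀ w → transpose y z (transpose x y (transpose y z w)) ≡ transpose x z w
  transpose-conjugate {x} {y} {z} x≢y y≢z x≢z w = by-cases (w ≟ᶠ x) (w ≟ᶠ y) (w ≟ᶠ z)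
    where
    by-cases : Dec (w ≡ x) → Dec (w ≡ y) → Dec (w ≡ z) →
      transpose y z (transpose x y (transpose y z w)) ≡ transpose x z w
    by-cases (yes refl) _ _
      rewrite transpose-mismatch x≢y x≢z | transpose-matchˡ x y | transpose-matchˡ y z
            | transpose-matchˡ x z = refl
    by-cases (no _) (yes refl) _
      rewrite transpose-matchˡ y z | transpose-mismatch (≢-sym x≢z) (≢-sym y≢z) | transpose-matchʳ y z
            | transpose-mismatch (≢-sym x≢y) y≢z = refl
    by-cases (no _) (no _) (yes refl)
      rewrite transpose-matchʳ y z | transpose-matchʳ x y | transpose-mismatch x≢y x≢z
            | transpose-matchʳ x z = refl
    by-cases (no w≢x) (no w≢y) (no w≢z)
      rewrite transpose-mismatch w≢y w≢z | transpose-mismatch w≢x w≢y | transpose-mismatch w≢y w≢z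
            | transpose-mismatch w≢x w≢z = refl

  lookup-transposition : ∀ (a b x : Fin n) → lookup (transposition a b) x ≡ transpose a b x
  lookup-transposition a b x = lookup∘tabulate _ x

  lookup-compose : ∀ (g σ : Perm n) x → lookup (compose g σ) x ≡ lookup g (lookup σ x)
  lookup-compose g σ x = lookup∘tabulate _ x

  lookup-idPerm : ∀ x → lookup (idPerm {n}) x ≡ x
  lookup-idPerm x = lookup∘tabulate _ x

  lookup-compose-transposition : ∀ (a b : Fin n) σ x →
    lookup (compose (transposition a b) σ) x ≡ transpose a b (lookup σ x)
  lookup-compose-transposition a b σ x =
    trans (lookup-compose (transposition a b) σ x) (lookup-transposition a b _)

  transposition-comm : ∀ (a b : Fin n) → transposition a b ≡ transposition b a
  transposition-comm a b = lookup-ext λ x → begin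
    lookup (transposition a b) x ≡⟨ lookup-transposition a b x ⟩
    transpose a b x              ≡⟨ transpose-comm a b x ⟩
    transpose b a x              ≡⟨ lookup-transposition b a x ⟨
    lookup (transposition b a) x ∎
    where open ≡-Reasoning

  transposition-self : ∀ (a : Fin n) → transposition a a ≡ idPerm
  transposition-self a = lookup-ext λ x →
    trans (lookup-transposition a a x) (trans (transpose-self a x) (sym (lookup-idPerm x)))

  transposition-cancel : ∀ (a b : Fin n) σ →
    compose (transposition a b) (compose (transposition a b) σ) ≡ σ
  transposition-cancel a b σ = lookup-ext λ x → begin
    lookup (compose (transposition a b) (compose (transposition a b) σ)) x
      ≡⟨ lookup-compose-transposition a b (compose (transposition a b) σ) x ⟩
    transpose a b (lookup (compose (transposition a b) σ) x)
      ≡⟨ cong (transpose a b) (lookup-compose-transposition a b σ x) ⟩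
    transpose a b (transpose a b (lookup σ x))
      ≡⟨ transpose-involutive a b _ ⟩
    lookup σ x ∎
    where open ≡-Reasoning

  compose-transposition-injective : ∀ (a b : Fin n) {σ σ'} →
    compose (transposition a b) σ ≡ compose (transposition a b) σ' → σ ≡ σ'
  compose-transposition-injective a b {σ} {σ'} eq = begin
    σ                                                          ≡⟨ transposition-cancel a b σ ⟨
    compose (transposition a b) (compose (transposition a b) σ)  ≡⟨ cong (compose (transposition a b)) eq ⟩
    compose (transposition a b) (compose (transposition a b) σ') ≡⟨ transposition-cancel a b σ' ⟩
    σ'                                                         ∎
    where open ≡-Reasoning

  transposition-conjugate : ∀ {x y z : Fin n} → x ≢ y → y ≢ z → x ≢ z →
    compose (transposition y z) (compose (transposition x y) (transposition y z)) ≡ transposition x z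
  transposition-conjugate {x} {y} {z} x≢y y≢z x≢z = lookup-ext λ w → begin
    lookup (compose (transposition y z) (compose (transposition x y) (transposition y z))) w
      ≡⟨ lookup-compose-transposition y z (compose (transposition x y) (transposition y z)) w ⟩
    transpose y z (lookup (compose (transposition x y) (transposition y z)) w)
      ≡⟨ cong (transpose y z) (lookup-compose-transposition x y (transposition y z) w) ⟩
    transpose y z (transpose x y (lookup (transposition y z) w))
      ≡⟨ cong (transpose y z ∘ transpose x y) (lookup-transposition y z w) ⟩
    transpose y z (transpose x y (transpose y z w))
      ≡⟨ transpose-conjugate x≢y y≢z x≢z w ⟩
    transpose x z w
      ≡⟨ lookup-transposition x z w ⟨
    lookup (transposition x z) w ∎
    where open ≡-Reasoning

  injective⇒IsPerm : ∀ (w : Perm n) → (∀ i i' → lookup w i ≡ lookup w i' → i ≡ i') → IsPerm w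
  injective⇒IsPerm w w-inj = w-inj , injective⇒surjective (w-inj _ _)

  IsPerm-idPerm : IsPerm (idPerm {n})
  IsPerm-idPerm = injective⇒IsPerm idPerm λ i i' eq →
    trans (sym (lookup-idPerm i)) (trans eq (lookup-idPerm i'))

  IsPerm-transposition : ∀ (a b : Fin n) → IsPerm (transposition a b)
  IsPerm-transposition a b = injective⇒IsPerm (transposition a b) λ i i' eq → begin
    i                                             ≡⟨ transpose-involutive a b i ⟨
    transpose a b (transpose a b i)               ≡⟨ cong (transpose a b) (lookup-transposition a b i) ⟨
    transpose a b (lookup (transposition a b) i)  ≡⟨ cong (transpose a b) eq ⟩
    transpose a b (lookup (transposition a b) i') ≡⟨ cong (transpose a b) (lookup-transposition a b i') ⟩
    transpose a b (transpose a b i')              ≡⟨ transpose-involutive a b i' ⟩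
    i'                                            ∎
    where open ≡-Reasoning

  IsPerm-compose : ∀ (g σ : Perm n) → IsPerm g → IsPerm σ → IsPerm (compose g σ)
  IsPerm-compose g σ (g-inj , _) (σ-inj , _) = injective⇒IsPerm (compose g σ) λ i i' eq →
    σ-inj i i' (g-inj _ _ (trans (sym (lookup-compose g σ i)) (trans eq (lookup-compose g σ i'))))

  compose-identityˡ : ∀ (σ : Perm n) → compose idPerm σ ≡ σ
  compose-identityˡ σ = lookup-ext λ x → trans (lookup-compose idPerm σ x) (lookup-idPerm _)

  compose-identityʳ : ∀ (σ : Perm n) → compose σ idPerm ≡ σ
  compose-identityʳ σ = lookup-ext λ x → trans (lookup-compose σ idPerm x) (cong (lookup σ) (lookup-idPerm x))

  compose-assoc : ∀ (g σ ρ : Perm n) → compose (compose g σ) ρ ≡ compose g (compose σ ρ)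
  compose-assoc g σ ρ = lookup-ext λ x → begin
    lookup (compose (compose g σ) ρ) x ≡⟨ lookup-compose (compose g σ) ρ x ⟩
    lookup (compose g σ) (lookup ρ x)  ≡⟨ lookup-compose g σ _ ⟩
    lookup g (lookup σ (lookup ρ x))   ≡⟨ cong (lookup g) (lookup-compose σ ρ x) ⟨
    lookup g (lookup (compose σ ρ) x)  ≡⟨ lookup-compose g (compose σ ρ) x ⟨
    lookup (compose g (compose σ ρ)) x ∎
    where open ≡-Reasoning

  module _ {G : Perm n → Set} where

    Generated-compose : ∀ {σ ρ} → Generated G σ → Generated G ρ → Generated G (compose σ ρ)
    Generated-compose {ρ = ρ} gen-id ρ∈⟨G⟩ = subst (Generated G) (sym (compose-identityˡ ρ)) ρ∈⟨G⟩
    Generated-compose {ρ = ρ} (gen-step {g} {σ} g∈G σ∈⟨G⟩) ρ∈⟨G⟩ =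
      subst (Generated G) (sym (compose-assoc g σ ρ)) (gen-step g∈G (Generated-compose σ∈⟨G⟩ ρ∈⟨G⟩))

    Generated-generator : ∀ {g} → G g → Generated G g
    Generated-generator {g} g∈G = subst (Generated G) (compose-identityʳ g) (gen-step g∈G gen-id)

module _ {m n : ℕ} {G : Perm n → Set} (c : Fin m → Fin n) (c-injective : Injective _≡_ _≡_ c)
         (adjacent : ∀ i i' → suc (toℕ i) ≡ toℕ i' → Generated G (transposition (c i) (c i'))) where

  private
    c-≢ : ∀ {i i'} → toℕ i < toℕ i' → c i ≢ c i'
    c-≢ i<i' ci≡ci' = <⇒≢ i<i' (cong toℕ (c-injective ci≡ci'))

  -- Induction on the distance: with y the index just before i', (c_y c_i')(c_i c_y)(c_y c_i') = (c_i c_i').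
  transposition-at-distance : ∀ d i i' → d + suc (toℕ i) ≡ toℕ i' → Generated G (transposition (c i) (c i'))
  transposition-at-distance zero    i i' adj = adjacent i i' adj
  transposition-at-distance (suc d) i i' dist =
    subst (Generated G) (transposition-conjugate (c-≢ i<y) (c-≢ y<i') (c-≢ (<-trans i<y y<i')))
      (Generated-compose y↔i' (Generated-compose i↔y y↔i'))
    where
    y : Fin m
    y = fromℕ< (subst (_≤ m) (sym dist) (<⇒≤ (toℕ<n i')))
    toℕ-y : toℕ y ≡ d + suc (toℕ i)
    toℕ-y = toℕ-fromℕ< _
    i<y : toℕ i < toℕ y
    i<y = subst (toℕ i <_) (sym toℕ-y) (m≤n+m (suc (toℕ i)) d)
    y<i' : toℕ y < toℕ i'
    y<i' = subst (_≤ toℕ i') (cong suc (sym toℕ-y)) (≤-reflexive dist)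
    i↔y : Generated G (transposition (c i) (c y))
    i↔y = transposition-at-distance d i y (sym toℕ-y)
    y↔i' : Generated G (transposition (c y) (c i'))
    y↔i' = adjacent y i' (trans (cong suc toℕ-y) dist)

  transposition-generated : ∀ i i' → Generated G (transposition (c i) (c i'))
  transposition-generated i i' with <-cmp (toℕ i) (toℕ i')
  ... | tri< i<i' _ _ = transposition-at-distance _ i i' (m∸n+n≡m i<i')
  ... | tri≈ _ i≡i' _ rewrite toℕ-injective i≡i' | transposition-self (c i') = gen-id
  ... | tri> _ _ i'<i rewrite transposition-comm (c i) (c i') = transposition-at-distance _ i' i (m∸n+n≡m i'<i)

module OrderedPartition {n : ℕ} (b : Fin n → ℕ) where

  Preserves : Perm n → Set
  Preserves τ = ∀ i → b (lookup τ i) ≡ b i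

  Preserves-compose : ∀ g σ → Preserves g → Preserves σ → Preserves (compose g σ)
  Preserves-compose g σ g-preserves σ-preserves i =
    trans (cong b (lookup-compose g σ i)) (trans (g-preserves (lookup σ i)) (σ-preserves i))

  Preserves-transposition : ∀ p q → b p ≡ b q → Preserves (transposition p q)
  Preserves-transposition p q bp≡bq x = trans (cong b (lookup-transposition p q x)) (same-block x)
    where
    same-block : ∀ x → b (transpose p q x) ≡ b x
    same-block x with transpose p q x | transpose-view p q x
    ... | _ | at-a refl     = sym bp≡bq
    ... | _ | at-b _ refl   = bp≡bq
    ... | _ | elsewhere _ _ = refl

  Generated⇒preserves : ∀ {G} → (∀ {g} → G g → IsPerm g × Preserves g) →
    ∀ {τ} → Generated G τ → IsPerm τ × Preserves τ
  Generated⇒preserves G-preserves gen-id = IsPerm-idPerm , λ i → cong b (lookup-idPerm i)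
  Generated⇒preserves G-preserves (gen-step {g} {σ} g∈G σ∈⟨G⟩) =
    let g-perm , g-preserves = G-preserves g∈G
        σ-perm , σ-preserves = Generated⇒preserves G-preserves σ∈⟨G⟩
    in IsPerm-compose g σ g-perm σ-perm , Preserves-compose g σ g-preserves σ-preserves

  -- With b = blk α, OnFace and StabilizesFace unfold to InFace α and Stabilizes α.
  OnFace : Perm n → Set
  OnFace x = ∀ i i' → b i < b i' → toℕ (lookup x i) < toℕ (lookup x i')

  StabilizesFace : Perm n → Set
  StabilizesFace τ = ∀ x y → IsPerm x → IsPerm y → Acts τ x y → (OnFace x → OnFace y) × (OnFace y → OnFace x)

  preserves⇒stabilizesFace : ∀ τ → IsPerm τ → Preserves τ → StabilizesFace τ
  preserves⇒stabilizesFace τ (_ , τ-surjective) τ-preserves x y _ _ y∘τ≡x = x∈F⇒y∈F , y∈F⇒x∈F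
    where
    x∈F⇒y∈F : OnFace x → OnFace y
    x∈F⇒y∈F x∈F j j' bj<bj' with i , refl ← τ-surjective j | i' , refl ← τ-surjective j' =
      subst₂ (λ u v → toℕ u < toℕ v) (sym (y∘τ≡x i)) (sym (y∘τ≡x i'))
        (x∈F i i' (subst₂ _<_ (τ-preserves i) (τ-preserves i') bj<bj'))
    y∈F⇒x∈F : OnFace y → OnFace x
    y∈F⇒x∈F y∈F i i' bi<bi' = subst₂ (λ u v → toℕ u < toℕ v) (y∘τ≡x i) (y∘τ≡x i')
      (y∈F (lookup τ i) (lookup τ i') (subst₂ _<_ (sym (τ-preserves i)) (sym (τ-preserves i')) bi<bi'))

  private
    allFin! : Unique (allFin n)
    allFin! = Unique.allFin⁺ n

  lo hi : ℕ → ℕ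
  lo a = length (filter (λ i → b i <? a) (allFin n))
  hi a = length (filter (λ i → b i ≤? a) (allFin n))

  onFace⇒lo≤position : ∀ x → IsPerm x → OnFace x → ∀ i → lo (b i) ≤ toℕ (lookup x i)
  onFace⇒lo≤position x (x-injective , _) x∈F i = begin
    lo (b i)                         ≤⟨ unique-injection⇒length-≤ position-injective earlier! earlier ⟩
    length (upTo (toℕ (lookup x i))) ≡⟨ length-upTo _ ⟩
    toℕ (lookup x i)                 ∎
    where
    open ≤-Reasoning
    position-injective : ∀ {i i'} → toℕ (lookup x i) ≡ toℕ (lookup x i') → i ≡ i'
    position-injective eq = x-injective _ _ (toℕ-injective eq)
    earlier! : Unique (filter (λ i' → b i' <? b i) (allFin n))
    earlier! = Unique.filter⁺ (λ i' → b i' <? b i) allFin!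
    earlier : ∀ {i'} → i' ∈ filter (λ i' → b i' <? b i) (allFin n) → toℕ (lookup x i') ∈ upTo (toℕ (lookup x i))
    earlier i'∈ = ∈-upTo⁺ (x∈F _ i (∈-filter-allFin⁻ (λ i' → b i' <? b i) i'∈))

  onFace⇒position<hi : ∀ x → IsPerm x → OnFace x → ∀ i → toℕ (lookup x i) < hi (b i)
  onFace⇒position<hi x (_ , x-surjective) x∈F i = begin-strict
    toℕ (lookup x i)                         <⟨ n<1+n _ ⟩
    suc (toℕ (lookup x i))                   ≡⟨ length-tabulate (λ v → v) ⟨
    length (allFin (suc (toℕ (lookup x i))))
      ≤⟨ unique-injection⇒length-≤ preimage-injective (Unique.allFin⁺ _) not-later ⟩
    hi (b i)                                 ∎
    where
    open ≤-Reasoning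
    embed : Fin (suc (toℕ (lookup x i))) → Fin n
    embed v = inject≤ v (toℕ<n (lookup x i))
    preimage : Fin (suc (toℕ (lookup x i))) → Fin n
    preimage v = proj₁ (x-surjective (embed v))
    x∘preimage≡embed : ∀ v → lookup x (preimage v) ≡ embed v
    x∘preimage≡embed v = proj₂ (x-surjective (embed v))
    preimage-injective : ∀ {v v'} → preimage v ≡ preimage v' → v ≡ v'
    preimage-injective {v} {v'} eq = inject≤-injective _ _ v v'
      (trans (sym (x∘preimage≡embed v)) (trans (cong (lookup x) eq) (x∘preimage≡embed v')))
    not-later : ∀ {v} → v ∈ allFin _ → preimage v ∈ filter (λ i' → b i' ≤? b i) (allFin n)
    not-later {v} _ = ∈-filter-allFin⁺ (λ i' → b i' ≤? b i) (≮⇒≥ λ bi<b[pv] → 1+n≰n (begin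
      suc (toℕ (lookup x i))          ≤⟨ x∈F i (preimage v) bi<b[pv] ⟩
      toℕ (lookup x (preimage v))     ≡⟨ cong toℕ (x∘preimage≡embed v) ⟩
      toℕ (embed v)                   ≡⟨ toℕ-inject≤ v _ ⟩
      toℕ v                           ≤⟨ s≤s⁻¹ (toℕ<n v) ⟩
      toℕ (lookup x i)                ∎))

  hi≤lo : ∀ {a a'} → a < a' → hi a ≤ lo a'
  hi≤lo {a} {a'} a<a' = unique-⊆⇒length-≤ (Unique.filter⁺ _ allFin!) λ i∈ →
    ∈-filter-allFin⁺ (λ i → b i <? a') (≤-<-trans (∈-filter-allFin⁻ (λ i → b i ≤? a) i∈) a<a')

  onFace⇒position-< : ∀ x y → IsPerm x → IsPerm y → OnFace x → OnFace y →
    ∀ {i i'} → b i < b i' → toℕ (lookup x i) < toℕ (lookup y i')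
  onFace⇒position-< x y x-perm y-perm x∈F y∈F {i} {i'} bi<bi' = begin-strict
    toℕ (lookup x i)  <⟨ onFace⇒position<hi x x-perm x∈F i ⟩
    hi (b i)          ≤⟨ hi≤lo bi<bi' ⟩
    lo (b i')         ≤⟨ onFace⇒lo≤position y y-perm y∈F i' ⟩
    toℕ (lookup y i') ∎
    where open ≤-Reasoning

  same-position⇒same-block : ∀ x y → IsPerm x → IsPerm y → OnFace x → OnFace y →
    ∀ {i i'} → lookup x i ≡ lookup y i' → b i ≡ b i'
  same-position⇒same-block x y x-perm y-perm x∈F y∈F {i} {i'} xi≡yi' with <-cmp (b i) (b i')
  ... | tri< bi<bi' _ _ =
    contradiction (cong toℕ xi≡yi') (<⇒≢ (onFace⇒position-< x y x-perm y-perm x∈F y∈F bi<bi'))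
  ... | tri≈ _ bi≡bi' _ = bi≡bi'
  ... | tri> _ _ bi'<bi =
    contradiction (cong toℕ (sym xi≡yi')) (<⇒≢ (onFace⇒position-< y x y-perm x-perm y∈F x∈F bi'<bi))

  private
    open StrictTotalOrder (×-strictTotalOrder <-strictTotalOrder <-strictTotalOrder)
      using (compare; irrefl) renaming (_<_ to _<ₗₑₓ_; _<?_ to _<ₗₑₓ?_; trans to <ₗₑₓ-trans)

    key : Fin n → ℕ × ℕ
    key i = b i , toℕ i

    predecessors : Fin n → List (Fin n)
    predecessors i = filter (λ i' → key i' <ₗₑₓ? key i) (allFin n)

    rank : Fin n → ℕ
    rank i = length (predecessors i)

    unique-∷-predecessors : ∀ i → Unique (i ∷ predecessors i)
    unique-∷-predecessors i = All.tabulate i∉ ∷ Unique.filter⁺ _ allFin!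
      where
      i∉ : ∀ {i'} → i' ∈ predecessors i → i ≢ i'
      i∉ i'∈ refl = irrefl (refl , refl) (∈-filter-allFin⁻ (λ i' → key i' <ₗₑₓ? key i) i'∈)

    rank-< : ∀ {i i'} → key i <ₗₑₓ key i' → rank i < rank i'
    rank-< {i} {i'} i<i' = unique-⊆⇒length-≤ (unique-∷-predecessors i) ∷-predecessors⊆
      where
      ∷-predecessors⊆ : i ∷ predecessors i ⊆ predecessors i'
      ∷-predecessors⊆ (here refl) = ∈-filter-allFin⁺ (λ j → key j <ₗₑₓ? key i') i<i'
      ∷-predecessors⊆ (there j∈) = ∈-filter-allFin⁺ (λ j → key j <ₗₑₓ? key i')
        (<ₗₑₓ-trans (∈-filter-allFin⁻ (λ j → key j <ₗₑₓ? key i) j∈) i<i')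

    rank<n : ∀ i → rank i < n
    rank<n i = subst (rank i <_) (length-tabulate (λ v → v))
      (unique-⊆⇒length-≤ (unique-∷-predecessors i) (λ {j} _ → ∈-allFin j))

  canonicalVertex : Perm n
  canonicalVertex = tabulate (λ i → fromℕ< (rank<n i))

  private
    toℕ-canonicalVertex : ∀ i → toℕ (lookup canonicalVertex i) ≡ rank i
    toℕ-canonicalVertex i = trans (cong toℕ (lookup∘tabulate _ i)) (toℕ-fromℕ< (rank<n i))

    canonicalVertex-≢ : ∀ {i i'} → key i <ₗₑₓ key i' → lookup canonicalVertex i ≢ lookup canonicalVertex i'
    canonicalVertex-≢ {i} {i'} i<i' eq =
      <⇒≢ (rank-< i<i') (trans (sym (toℕ-canonicalVertex i)) (trans (cong toℕ eq) (toℕ-canonicalVertex i')))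

  canonicalVertex-injective : ∀ i i' → lookup canonicalVertex i ≡ lookup canonicalVertex i' → i ≡ i'
  canonicalVertex-injective i i' eq with compare (key i) (key i')
  ... | tri< i<i' _ _        = contradiction eq (canonicalVertex-≢ i<i')
  ... | tri≈ _ (_ , i≡i') _  = toℕ-injective i≡i'
  ... | tri> _ _ i'<i        = contradiction (sym eq) (canonicalVertex-≢ i'<i)

  IsPerm-canonicalVertex : IsPerm canonicalVertex
  IsPerm-canonicalVertex = injective⇒IsPerm canonicalVertex canonicalVertex-injective

  canonicalVertex-onFace : OnFace canonicalVertex
  canonicalVertex-onFace i i' bi<bi' =
    subst₂ _<_ (sym (toℕ-canonicalVertex i)) (sym (toℕ-canonicalVertex i')) (rank-< (inj₁ bi<bi'))

  -- y = τ·v is again on the face, and there the position y(τ i) = v(i) determines the block.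
  stabilizesFace⇒preserves : ∀ τ → IsPerm τ → StabilizesFace τ → Preserves τ
  stabilizesFace⇒preserves τ (τ-injective , τ-surjective) τ-stabilizes i =
    same-position⇒same-block y v IsPerm-y IsPerm-canonicalVertex y∈F canonicalVertex-onFace (y∘τ≡v i)
    where
    v : Perm n
    v = canonicalVertex
    τ⁻¹ : Fin n → Fin n
    τ⁻¹ j = proj₁ (τ-surjective j)
    y : Perm n
    y = tabulate (λ j → lookup v (τ⁻¹ j))
    lookup-y : ∀ j → lookup y j ≡ lookup v (τ⁻¹ j)
    lookup-y j = lookup∘tabulate _ j
    y∘τ≡v : Acts τ v y
    y∘τ≡v i = trans (lookup-y _) (cong (lookup v) (τ-injective _ _ (proj₂ (τ-surjective (lookup τ i)))))
    IsPerm-y : IsPerm y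
    IsPerm-y = injective⇒IsPerm y λ j j' eq → begin
      j                 ≡⟨ proj₂ (τ-surjective j) ⟨
      lookup τ (τ⁻¹ j)  ≡⟨ cong (lookup τ) (canonicalVertex-injective _ _ (v∘τ⁻¹-≡ eq)) ⟩
      lookup τ (τ⁻¹ j') ≡⟨ proj₂ (τ-surjective j') ⟩
      j'                ∎
      where
      open ≡-Reasoning
      v∘τ⁻¹-≡ : ∀ {j j'} → lookup y j ≡ lookup y j' → lookup v (τ⁻¹ j) ≡ lookup v (τ⁻¹ j')
      v∘τ⁻¹-≡ {j} {j'} eq = trans (sym (lookup-y j)) (trans eq (lookup-y j'))
    y∈F : OnFace y
    y∈F = proj₁ (τ-stabilizes v y IsPerm-canonicalVertex IsPerm-y y∘τ≡v) canonicalVertex-onFace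

  SupportedOn : List (Fin n) → Perm n → Set
  SupportedOn ps τ = ∀ i → i ∉ ps → lookup τ i ≡ i

  BlockPerm : List (Fin n) → Perm n → Set
  BlockPerm ps τ = IsPerm τ × Preserves τ × SupportedOn ps τ

  sameBlock : Fin n → List (Fin n) → List (Fin n)
  sameBlock p ps = filter (λ q → b q ≟ b p) ps

  -- A block permutation τ on p ∷ ps is (p q) ∘ τ' with q = τ(p) in the block of p
  -- and τ' = (p q) ∘ τ a block permutation on ps.
  blockPerms : List (Fin n) → List (Perm n)
  blockPerms []       = idPerm ∷ []
  blockPerms (p ∷ ps) =
    cartesianProductWith (λ q → compose (transposition p q)) (p ∷ sameBlock p ps) (blockPerms ps)

  private
    ∈-sameBlock⁻ : ∀ p ps {q} → q ∈ p ∷ sameBlock p ps → q ∈ p ∷ ps × b p ≡ b q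
    ∈-sameBlock⁻ p ps (here refl) = here refl , refl
    ∈-sameBlock⁻ p ps (there q∈) =
      let q∈ps , bq≡bp = ∈-filter⁻ (λ q → b q ≟ b p) {xs = ps} q∈ in there q∈ps , sym bq≡bp

    ∉-∷ : ∀ {i p} {ps : List (Fin n)} → i ≢ p → i ∉ ps → i ∉ p ∷ ps
    ∉-∷ i≢p i∉ps (here i≡p)   = i≢p i≡p
    ∉-∷ i≢p i∉ps (there i∈ps) = i∉ps i∈ps

  BlockPerm-extend : ∀ p ps q τ → q ∈ p ∷ sameBlock p ps → BlockPerm ps τ →
    BlockPerm (p ∷ ps) (compose (transposition p q) τ)
  BlockPerm-extend p ps q τ q∈ (τ-perm , τ-preserves , τ-supported) =
    IsPerm-compose (transposition p q) τ (IsPerm-transposition p q) τ-perm ,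
    Preserves-compose (transposition p q) τ (Preserves-transposition p q bp≡bq) τ-preserves ,
    supported
    where
    bp≡bq : b p ≡ b q
    bp≡bq = proj₂ (∈-sameBlock⁻ p ps q∈)
    supported : SupportedOn (p ∷ ps) (compose (transposition p q) τ)
    supported i i∉ = begin
      lookup (compose (transposition p q) τ) i ≡⟨ lookup-compose-transposition p q τ i ⟩
      transpose p q (lookup τ i)               ≡⟨ cong (transpose p q) (τ-supported i (i∉ ∘ there)) ⟩
      transpose p q i                          ≡⟨ transpose-mismatch (i∉ ∘ here) i≢q ⟩
      i                                        ∎
      where
      open ≡-Reasoning
      i≢q : i ≢ q
      i≢q refl = i∉ (proj₁ (∈-sameBlock⁻ p ps q∈))

  BlockPerm-image : ∀ p ps τ → BlockPerm (p ∷ ps) τ → lookup τ p ∈ p ∷ sameBlock p ps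
  BlockPerm-image p ps τ ((τ-injective , _) , τ-preserves , τ-supported)
    with lookup τ p ≟ᶠ p | Any.any? (lookup τ p ≟ᶠ_) ps
  ... | yes τp≡p | _         = here τp≡p
  ... | no _     | yes τp∈ps = there (∈-filter⁺ (λ r → b r ≟ b p) τp∈ps (τ-preserves p))
  ... | no τp≢p  | no τp∉ps  =
    contradiction (τ-injective _ p (τ-supported (lookup τ p) (∉-∷ τp≢p τp∉ps))) τp≢p

  BlockPerm-restrict : ∀ p ps τ → BlockPerm (p ∷ ps) τ → BlockPerm ps (compose (transposition p (lookup τ p)) τ)
  BlockPerm-restrict p ps τ (τ-perm@(τ-injective , _) , τ-preserves , τ-supported) =
    IsPerm-compose (transposition p q) τ (IsPerm-transposition p q) τ-perm ,
    Preserves-compose (transposition p q) τ (Preserves-transposition p q (sym (τ-preserves p))) τ-preserves ,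
    supported
    where
    q : Fin n
    q = lookup τ p
    supported : SupportedOn ps (compose (transposition p q) τ)
    supported i i∉ps with i ≟ᶠ p
    ... | yes refl = trans (lookup-compose-transposition p q τ i) (transpose-matchʳ p q)
    ... | no i≢p = begin
      lookup (compose (transposition p q) τ) i ≡⟨ lookup-compose-transposition p q τ i ⟩
      transpose p q (lookup τ i)               ≡⟨ cong (transpose p q) τi≡i ⟩
      transpose p q i                          ≡⟨ transpose-mismatch i≢p i≢q ⟩
      i                                        ∎
      where
      open ≡-Reasoning
      τi≡i : lookup τ i ≡ i
      τi≡i = τ-supported i (∉-∷ i≢p i∉ps)
      i≢q : i ≢ q
      i≢q i≡q = i≢p (τ-injective i p (trans τi≡i i≡q))

  blockPerms-sound : ∀ ps {τ} → τ ∈ blockPerms ps → BlockPerm ps τ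
  blockPerms-sound [] (here refl) = IsPerm-idPerm , (λ i → cong b (lookup-idPerm i)) , λ i _ → lookup-idPerm i
  blockPerms-sound (p ∷ ps) τ∈
    with q , τ' , q∈ , τ'∈ , refl ← ∈-cartesianProductWith⁻ _ (p ∷ sameBlock p ps) (blockPerms ps) τ∈ =
    BlockPerm-extend p ps q τ' q∈ (blockPerms-sound ps τ'∈)

  blockPerms-complete : ∀ ps τ → BlockPerm ps τ → τ ∈ blockPerms ps
  blockPerms-complete [] τ (_ , _ , τ-supported) =
    here (lookup-ext λ i → trans (τ-supported i λ ()) (sym (lookup-idPerm i)))
  blockPerms-complete (p ∷ ps) τ τ-block =
    subst (_∈ blockPerms (p ∷ ps)) (transposition-cancel p q τ)
      (∈-cartesianProductWith⁺ (λ q → compose (transposition p q)) (BlockPerm-image p ps τ τ-block)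
        (blockPerms-complete ps (compose (transposition p q) τ) (BlockPerm-restrict p ps τ τ-block)))
    where
    q : Fin n
    q = lookup τ p

  private
    unique-transposition-products : ∀ (p : Fin n) qs τs →
      Unique qs → Unique τs → All (λ τ → lookup τ p ≡ p) τs →
      Unique (cartesianProductWith (λ q → compose (transposition p q)) qs τs)
    unique-transposition-products p []       τs _              _   _     = []
    unique-transposition-products p (q ∷ qs) τs (q∉qs ∷ qs!) τs! fixes =
      Unique.++⁺ (Unique.map⁺ (compose-transposition-injective p q) τs!)
                 (unique-transposition-products p qs τs qs! τs! fixes) disjoint
      where
      sends-p-to : ∀ r {τ} → τ ∈ τs → lookup (compose (transposition p r) τ) p ≡ r
      sends-p-to r {τ} τ∈ = trans (lookup-compose-transposition p r τ p)
        (trans (cong (transpose p r) (All.lookup fixes τ∈)) (transpose-matchˡ p r))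
      disjoint : Disjoint (map (compose (transposition p q)) τs)
                          (cartesianProductWith (λ q → compose (transposition p q)) qs τs)
      disjoint (σ∈here , σ∈rest)
        with τ , τ∈ , refl ← ∈-map⁻ (compose (transposition p q)) σ∈here
        | q' , τ' , q'∈ , τ'∈ , eq ← ∈-cartesianProductWith⁻ _ qs τs σ∈rest =
        All.lookup q∉qs q'∈ (begin
          q                                           ≡⟨ sends-p-to q τ∈ ⟨
          lookup (compose (transposition p q) τ) p    ≡⟨ cong (λ σ → lookup σ p) eq ⟩
          lookup (compose (transposition p q') τ') p  ≡⟨ sends-p-to q' τ'∈ ⟩
          q'                                          ∎)
        where open ≡-Reasoning

  blockPerms-unique : ∀ ps → Unique ps → Unique (blockPerms ps)
  blockPerms-unique []       _             = All.[] ∷ []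
  blockPerms-unique (p ∷ ps) (p∉ps ∷ ps!) =
    unique-transposition-products p (p ∷ sameBlock p ps) (blockPerms ps)
      (All.tabulate p∉sameBlock ∷ Unique.filter⁺ _ ps!) (blockPerms-unique ps ps!) (All.tabulate fixes-p)
    where
    p∉sameBlock : ∀ {q} → q ∈ sameBlock p ps → p ≢ q
    p∉sameBlock q∈ = All.lookup p∉ps (proj₁ (∈-filter⁻ (λ q → b q ≟ b p) {xs = ps} q∈))
    fixes-p : ∀ {τ} → τ ∈ blockPerms ps → lookup τ p ≡ p
    fixes-p τ∈ = proj₂ (proj₂ (blockPerms-sound ps τ∈)) p λ p∈ps → All.lookup p∉ps p∈ps refl

  blockPerms-generated : ∀ {G} → (∀ p q → b p ≡ b q → Generated G (transposition p q)) →
    ∀ ps {τ} → τ ∈ blockPerms ps → Generated G τ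
  blockPerms-generated swap∈⟨G⟩ [] (here refl) = gen-id
  blockPerms-generated swap∈⟨G⟩ (p ∷ ps) τ∈
    with q , τ' , q∈ , τ'∈ , refl ← ∈-cartesianProductWith⁻ _ (p ∷ sameBlock p ps) (blockPerms ps) τ∈ =
    Generated-compose (swap∈⟨G⟩ p q (proj₂ (∈-sameBlock⁻ p ps q∈))) (blockPerms-generated swap∈⟨G⟩ ps τ'∈)

  blockSize : ℕ → List (Fin n) → ℕ
  blockSize a ps = length (filter (λ q → b q ≟ a) ps)

  length-blockPerms : ∀ {k} ps → All (λ p → b p < k) ps →
    length (blockPerms ps) ≡ product (List.tabulate {n = k} (λ a → blockSize (toℕ a) ps !))
  length-blockPerms {k} [] All.[] = sym (product-tabulate-1 k)
  length-blockPerms {k} (p ∷ ps) (bp<k All.∷ bounded) = begin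
    length (blockPerms (p ∷ ps))
      ≡⟨ length-cartesianProductWith _ (p ∷ sameBlock p ps) (blockPerms ps) ⟩
    suc (blockSize (b p) ps) * length (blockPerms ps)
      ≡⟨ cong (suc (blockSize (b p) ps) *_) (length-blockPerms ps bounded) ⟩
    suc (blockSize (b p) ps) * product (List.tabulate {n = k} (λ a → blockSize (toℕ a) ps !))
      ≡⟨ product-tabulate-scale (λ a → blockSize (toℕ a) ps !) (λ a → blockSize (toℕ a) (p ∷ ps) !)
           (suc (blockSize (b p) ps)) (fromℕ< bp<k) at-bp away-from-bp ⟨
    product (List.tabulate {n = k} (λ a → blockSize (toℕ a) (p ∷ ps) !)) ∎
    where
    open ≡-Reasoning
    at-bp : blockSize (toℕ (fromℕ< bp<k)) (p ∷ ps) ! ≡ suc (blockSize (b p) ps) * blockSize (toℕ (fromℕ< bp<k)) ps !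
    at-bp rewrite toℕ-fromℕ< bp<k | filter-accept (λ q → b q ≟ b p) {x = p} {xs = ps} refl = refl
    away-from-bp : ∀ a → a ≢ fromℕ< bp<k → blockSize (toℕ a) (p ∷ ps) ! ≡ blockSize (toℕ a) ps !
    away-from-bp a a≢ rewrite filter-reject (λ q → b q ≟ toℕ a) {x = p} {xs = ps}
      (λ bp≡a → a≢ (toℕ-injective (trans (sym bp≡a) (sym (toℕ-fromℕ< bp<k))))) = refl

  ∈-blockPerms⇒stabilizesFace : ∀ {τ} → τ ∈ blockPerms (allFin n) → IsPerm τ × StabilizesFace τ
  ∈-blockPerms⇒stabilizesFace {τ} τ∈ =
    let τ-perm , τ-preserves , _ = blockPerms-sound (allFin n) τ∈
    in τ-perm , preserves⇒stabilizesFace τ τ-perm τ-preserves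

  stabilizesFace⇒∈-blockPerms : ∀ {τ} → IsPerm τ × StabilizesFace τ → τ ∈ blockPerms (allFin n)
  stabilizesFace⇒∈-blockPerms {τ} (τ-perm , τ-stabilizes) = blockPerms-complete (allFin n) τ
    (τ-perm , stabilizesFace⇒preserves τ τ-perm τ-stabilizes , λ i i∉ → contradiction (∈-allFin i) i∉)

length-diffs : ∀ p bs → length (diffs p bs) ≡ length bs
length-diffs p []       = refl
length-diffs p (b ∷ bs) = cong suc (length-diffs b bs)

last∈breakpoints : ∀ {n} (α : Vec ℕ (suc n)) → (∀ i → lookup α i ≤ suc n) → suc n ∈ breakpoints α
last∈breakpoints {n} α α≤ = ∈-filter⁺ (λ t → count≤ α t ≟ t) (∈-map⁺ suc (∈-upTo⁺ (n<1+n n))) all-counted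
  where
  all-counted : count≤ α (suc n) ≡ suc n
  all-counted = trans (cong length (filter-all (λ a → a ≤? suc n) {xs = toList α} (toList⁺ (lookup⁻ α≤))))
                      (length-toList α)

blk<numberOfPrimes : ∀ {n} (α : Vec ℕ n) → IsParkingFunction α → ∀ i → blk α i < length (primeLengths α)
blk<numberOfPrimes {suc n} α (α-preferences , α-spots) i = begin-strict
  blk α i                                        ≤⟨ ≤-refl ⟩
  length (filter (_<? spot α i) (breakpoints α)) <⟨ filter-notAll (_<? spot α i) (breakpoints α) last-not-before ⟩
  length (breakpoints α)                         ≡⟨ length-diffs 0 (breakpoints α) ⟨
  length (primeLengths α)                        ∎
  where
  open ≤-Reasoning
  not-before : ∀ {t} → suc n ≡ t → ¬ (t < spot α i)
  not-before refl n<spot = <⇒≱ n<spot (α-spots i)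
  last-not-before : Any.Any (λ t → ¬ (t < spot α i)) (breakpoints α)
  last-not-before = Any.map not-before (last∈breakpoints α (proj₂ ∘ α-preferences))

module ListedBlocks {n : ℕ} (α : Vec ℕ n) (α-parking : IsParkingFunction α)
                     (c : Listing α) (c-listing : IsListing α c) where
  open OrderedPartition (blk α)

  private
    c-block : ∀ j i → blk α (c j i) ≡ toℕ j
    c-block = proj₁ c-listing
    c-injective : ∀ j i i' → c j i ≡ c j i' → i ≡ i'
    c-injective = proj₁ (proj₂ c-listing)
    c-exhaustive : ∀ j x → blk α x ≡ toℕ j → ∃ λ i → c j i ≡ x
    c-exhaustive = proj₁ (proj₂ (proj₂ c-listing))

  listingGenerator-preserves : ∀ {g} → IsListingGenerator α c g → IsPerm g × Preserves g
  listingGenerator-preserves (j , i , i' , _ , refl) =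
    IsPerm-transposition (c j i) (c j i') ,
    Preserves-transposition (c j i) (c j i') (trans (c-block j i) (sym (c-block j i')))

  listed-transposition-generated : ∀ j i i' → Generated (IsListingGenerator α c) (transposition (c j i) (c j i'))
  listed-transposition-generated j = transposition-generated (c j) (λ {x} {y} → c-injective j x y)
    (λ i i' adj → Generated-generator (j , i , i' , adj , refl))

  sameBlock-transposition-generated : ∀ p q → blk α p ≡ blk α q → Generated (IsListingGenerator α c) (transposition p q)
  sameBlock-transposition-generated p q bp≡bq =
    subst₂ (λ u v → Generated (IsListingGenerator α c) (transposition u v)) (proj₂ p-listed) (proj₂ q-listed)
      (listed-transposition-generated j (proj₁ p-listed) (proj₁ q-listed))
    where
    bp<k : blk α p < length (primeLengths α)
    bp<k = blk<numberOfPrimes α α-parking p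
    j : Fin (length (primeLengths α))
    j = fromℕ< bp<k
    p-listed : ∃ λ i → c j i ≡ p
    p-listed = c-exhaustive j p (sym (toℕ-fromℕ< bp<k))
    q-listed : ∃ λ i → c j i ≡ q
    q-listed = c-exhaustive j q (trans (sym bp≡bq) (sym (toℕ-fromℕ< bp<k)))

  blockSize≡primeLength : ∀ j → blockSize (toℕ j) (allFin n) ≡ List.lookup (primeLengths α) j
  blockSize≡primeLength j = ≤-antisym
    (begin
      blockSize (toℕ j) (allFin n) ≤⟨ unique-⊆⇒length-≤ (Unique.filter⁺ _ (Unique.allFin⁺ n)) block⊆listed ⟩
      length (map (c j) (allFin ℓ)) ≡⟨ length-map (c j) (allFin ℓ) ⟩
      length (allFin ℓ)             ≡⟨ length-tabulate (λ v → v) ⟩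
      ℓ                             ∎)
    (begin
      ℓ                             ≡⟨ length-tabulate (λ v → v) ⟨
      length (allFin ℓ)             ≤⟨ unique-injection⇒length-≤ (λ {x} {y} → c-injective j x y) (Unique.allFin⁺ ℓ)
                                         (λ {i} _ → ∈-filter-allFin⁺ (λ q → blk α q ≟ toℕ j) (c-block j i)) ⟩
      blockSize (toℕ j) (allFin n) ∎)
    where
    open ≤-Reasoning
    ℓ : ℕ
    ℓ = List.lookup (primeLengths α) j
    block⊆listed : filter (λ q → blk α q ≟ toℕ j) (allFin n) ⊆ map (c j) (allFin ℓ)
    block⊆listed q∈ with i , refl ← c-exhaustive j _ (∈-filter-allFin⁻ (λ q → blk α q ≟ toℕ j) q∈) =
      ∈-map⁺ (c j) (∈-allFin i)

  length-blockPerms-allFin : length (blockPerms (allFin n)) ≡ product (map (λ l → l !) (primeLengths α))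
  length-blockPerms-allFin = begin
    length (blockPerms (allFin n))
      ≡⟨ length-blockPerms (allFin n) (All.tabulate λ {i} _ → blk<numberOfPrimes α α-parking i) ⟩
    product (List.tabulate {n = length (primeLengths α)} (λ j → blockSize (toℕ j) (allFin n) !))
      ≡⟨ cong product (tabulate-cong λ j → cong _! (blockSize≡primeLength j)) ⟩
    product (List.tabulate (λ j → List.lookup (primeLengths α) j !))
      ≡⟨ cong product (map-tabulate (List.lookup (primeLengths α)) _!) ⟨
    product (map _! (List.tabulate (List.lookup (primeLengths α))))
      ≡⟨ cong (product ∘ map _!) (tabulate-lookup (primeLengths α)) ⟩
    product (map (λ l → l !) (primeLengths α)) ∎
    where open ≡-Reasoning

  generated⇒inStabilizer : ∀ {τ} → Generated (IsListingGenerator α c) τ → InStabilizer α τ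
  generated⇒inStabilizer {τ} τ∈⟨G⟩ =
    let τ-perm , τ-preserves = Generated⇒preserves listingGenerator-preserves τ∈⟨G⟩
    in τ-perm , preserves⇒stabilizesFace τ τ-perm τ-preserves

  inStabilizer⇒generated : ∀ {τ} → InStabilizer α τ → Generated (IsListingGenerator α c) τ
  inStabilizer⇒generated τ∈stab =
    blockPerms-generated sameBlock-transposition-generated (allFin n) (stabilizesFace⇒∈-blockPerms τ∈stab)

proposition3p13 : (n : ℕ) (α : Vec ℕ n) → IsParkingFunction α → IsUnitInterval α →
    (c : Listing α) → IsListing α c →
    ((τ : Vec (Fin n) n) →
      (Generated (IsListingGenerator α c) τ → InStabilizer α τ) ×
      (InStabilizer α τ → Generated (IsListingGenerator α c) τ)) ×
    Σ (List (Vec (Fin n) n)) (λ L → Unique L ×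
      ((τ : Vec (Fin n) n) → (τ ∈ L → InStabilizer α τ) × (InStabilizer α τ → τ ∈ L)) ×
      length L ≡ product (map (λ l → l !) (primeLengths α)))
proposition3p13 n α α-parking _ c c-listing =
  (λ τ → generated⇒inStabilizer , inStabilizer⇒generated) ,
  blockPerms (allFin n) , blockPerms-unique (allFin n) (Unique.allFin⁺ n) ,
  (λ τ → ∈-blockPerms⇒stabilizesFace , stabilizesFace⇒∈-blockPerms) ,
  length-blockPerms-allFin
  where
  open OrderedPartition (blk α)
  open ListedBlocks α α-parking c c-listing
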